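{- Let $D\ne\pm 3$ be a squarefree integer with $D\neq 1$, let $K=\mathbb{Q}(\sqrt{D})$, and let $I\subset\mathcal{O}_K$ be a nonzero ideal. Then $|S(\Lambda_K(I))|\le 4$.
   Context: The embedding $\sigma:K\to\mathbb{R}^2$ is: if $D>1$, $\sigma(x)=(\sigma_1(x),\sigma_2(x))$ with the two real embeddings $\sqrt{D}\mapsto\pm\sqrt{D}$; if $D<0$, $\sigma(x)=(\Re\tau(x),\Im\tau(x))$ for a fixed complex embedding $\tau$. $\Lambda_K(I)=\sigma(I)$. For a full-rank lattice $\Lambda\subset\mathbb{R}^2$, $S(\Lambda)=\{x\in\Lambda:\|x\|^2=\min_{y\in\Lambda\setminus\{0\}}\|y\|^2\}$ is its set of minimal vectors (Euclidean norm), and $|S(\Lambda)|$ denotes its cardinality. -}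

module Defs where

open import Data.Nat as ℕ using (ℕ)
open import Data.Integer as ℤ using (ℤ; +_; -[1+_]; _+_; _*_; -_; _-_; ∣_∣; _≤_; _<_)
open import Data.Integer.DivMod using (_/_; _%_)
open import Data.Integer.Divisibility using () renaming (_∣_ to _∣ℤ_)
open import Data.Nat.Divisibility using (_∣_)
open import Data.Product using (Σ; _×_; _,_; ∃)
open import Data.Fin using (Fin)
open import Function.Definitions using (Injective)
open import Relation.Binary.PropositionalEquality using (_≡_; _≢_)
open import Relation.Nullary using (yes; no)
open import Data.Empty using (⊥)

-- Squarefree integer: the only natural n with n² ∣ D is n = 1 (so D ≠ 0).
Squarefree : ℤ → Set
Squarefree D = (n : ℕ) → (n ℕ.* n) ∣ ∣ D ∣ → n ≡ 1

-- Elements of K = ℚ(√D) are represented in "half coordinates":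
-- the pair (u , v) stands for (u + v √D) / 2.
Elt : Set
Elt = ℤ × ℤ

zeroE : Elt
zeroE = (+ 0 , + 0)

addE : Elt → Elt → Elt
addE (u₁ , v₁) (u₂ , v₂) = (u₁ + u₂ , v₁ + v₂)

negE : Elt → Elt
negE (u , v) = (- u , - v)

-- Membership in the ring of integers O_K (D squarefree, D ≠ 1):
-- if D ≡ 1 (mod 4): u ≡ v (mod 2); otherwise u, v both even
-- (i.e. O_K = ℤ[(1+√D)/2] resp. ℤ[√D]).
InOK : ℤ → Elt → Set
InOK D (u , v) with D % (+ 4)
... | 1 = (+ 2) ∣ℤ (u - v)
... | _ = ((+ 2) ∣ℤ u) × ((+ 2) ∣ℤ v)

-- Product in K:  ((u₁+v₁√D)/2)((u₂+v₂√D)/2)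
--   = ((u₁u₂ + D v₁v₂)/2 + ((u₁v₂ + u₂v₁)/2) √D) / 2 .
-- The divisions by 2 are exact for elements of O_K.
mulE : ℤ → Elt → Elt → Elt
mulE D (u₁ , v₁) (u₂ , v₂) =
  ((u₁ * u₂ + D * (v₁ * v₂)) / (+ 2) , (u₁ * v₂ + u₂ * v₁) / (+ 2))

record IsNonzeroIdeal (D : ℤ) (I : Elt → Set) : Set where
  field
    ⊆OK    : ∀ x → I x → InOK D x
    has0   : I zeroE
    closed+ : ∀ x y → I x → I y → I (addE x y)
    closed- : ∀ x → I x → I (negE x)
    closed* : ∀ r x → InOK D r → I x → I (mulE D r x)
    nonzero : ∃ λ x → I x × x ≢ zeroE

-- 4 · ‖σ(x)‖² for x = (u + v√D)/2:
--   D > 1 : σ₁(x)² + σ₂(x)² = (u² + D v²)/2,   so 4‖σ(x)‖² = 2(u² + D v²);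
--   D < 0 : |τ(x)|² = (u² − D v²)/4,           so 4‖σ(x)‖² = u² − D v².
-- (D = 0 and D = 1 never occur under the hypotheses.)
normSq4 : ℤ → Elt → ℤ
normSq4 D (u , v) with D ℤ.<? + 0
... | yes _ = u * u - D * (v * v)
... | no _  = (+ 2) * (u * u + D * (v * v))

-- x ∈ I gives a minimal vector σ(x) of Λ_K(I) = σ(I).
-- (σ is injective, so minimal vectors correspond bijectively to such x.)
IsMinimal : ℤ → (Elt → Set) → Elt → Set
IsMinimal D I x =
  I x × x ≢ zeroE × (∀ y → I y → y ≢ zeroE → normSq4 D x ≤ normSq4 D y)

AtMostFourMinimal : ℤ → (Elt → Set) → Set
AtMostFourMinimal D I =
  (f : Fin 5 → Elt) → Injective _≡_ _≡_ f → (∀ i → IsMinimal D I (f i)) → ⊥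

-- Up to a constant factor, the squared length of σ(x) for x = (u + v√D)/2 is the
-- binary quadratic form Q(u, v) = u² + |D| v², so all minimal vectors share one value
-- M of Q. Among five distinct minimal vectors there are three, x, y, z, no two of
-- them equal or opposite. As x ± y are nonzero lattice vectors, the polar form
-- P(x, y) = Q(x + y) − Q(x) − Q(y) satisfies |P(x, y)| ≤ M. Equality is impossible:
-- Lagrange's identity 4 Q(x) Q(y) = P(x, y)² + |D| (2 det(x, y))² would give
-- 3 M² = |D| κ², forcing the squarefree |D| to be 3. So |P(x, y)| < M, and the
-- vanishing of the Gram determinant of three plane vectors,
-- 4 M³ + P(x, y) P(x, z) P(y, z) = M (P(x, y)² + P(x, z)² + P(y, z)²),
-- contradicts these bounds.
module Submission where

open import Defs
open import Data.Integer using (ℤ; +_; -_)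
open import Data.Empty using (⊥; ⊥-elim)
open import Data.Fin using (Fin; #_)
open import Data.Product using (∃; _×_; _,_; proj₁; proj₂)
open import Data.Sum using (_⊎_; inj₁; inj₂)
open import Function using (_∘_)
open import Function.Definitions using (Injective)
open import Data.Product.Properties using (≡-dec)
open import Relation.Binary.Definitions using (DecidableEquality)
open import Relation.Binary.PropositionalEquality
open import Relation.Nullary using (¬_; yes; no)
open import Relation.Nullary.Decidable using (_⊎-dec_; toWitness)

module _ where

  open import Data.Nat
  open import Data.Nat.Properties
  open import Data.Nat.Divisibility
  open import Data.Nat.DivMod using (_/_; m/n*n≡m)
  open import Data.Nat.GCD using (gcd; gcd[m,n]∣m; gcd[m,n]∣n; gcd[m,n]≢0)
  open import Data.Nat.Coprimality using (Coprime; coprime-divisor; coprime-/gcd)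
  import Data.Nat.Coprimality as Coprime
  open import Data.Nat.Primality
    using (Prime; prime?; prime⇒irreducible; prime⇒nonZero; prime⇒nonTrivial; euclidsLemma)
  import Data.Nat.Tactic.RingSolver as ℕ-Solver
  open import Data.List using (_∷_; [])

  prime[3] : Prime 3
  prime[3] = toWitness {a? = prime? 3} _

  squarefree⇒≢0 : ∀ {e} → Squarefree (+ e) → e ≢ 0
  squarefree⇒≢0 sf refl with sf 0 ∣-refl
  ... | ()

  coprime∧p*m²≡e*k²⇒e≡p : ∀ {p e m k} → Prime p → Squarefree (+ e) → Coprime m k →
                           p * (m * m) ≡ e * (k * k) → e ≡ p
  coprime∧p*m²≡e*k²⇒e≡p {p} {e} {m} {k} pr sf cop eq with prime⇒irreducible pr k∣p
    where
    k∣m*[m*p] : k ∣ m * (m * p)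
    k∣m*[m*p] = subst (k ∣_) (trans (sym eq) (trans (*-comm p (m * m)) (*-assoc m m p)))
                  (∣-trans (m∣m*n k) (n∣m*n e))
    k∣p : k ∣ p
    k∣p = coprime-divisor (Coprime.sym cop) (coprime-divisor (Coprime.sym cop) k∣m*[m*p])
  ... | inj₁ refl = trans e≡p*m² (trans (cong (λ n → p * (n * n)) m≡1) (*-identityʳ p))
    where
    e≡p*m² : e ≡ p * (m * m)
    e≡p*m² = sym (trans eq (*-identityʳ e))
    m≡1 : m ≡ 1
    m≡1 = sf m (divides p e≡p*m²)
  ... | inj₂ refl = ⊥-elim (nonTrivial⇒≢1 (cop (p∣m , ∣-refl)))
    where
    instance _ = prime⇒nonZero pr
    instance _ = prime⇒nonTrivial pr
    m²≡e*p : m * m ≡ e * p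
    m²≡e*p = *-cancelˡ-≡ (m * m) (e * p) p
               (trans eq (trans (sym (*-assoc e p p)) (*-comm (e * p) p)))
    p∣m : p ∣ m
    p∣m with euclidsLemma m m pr (divides e m²≡e*p)
    ... | inj₁ p∣m = p∣m
    ... | inj₂ p∣m = p∣m

  p*m²≡e*k²⇒e≡p : ∀ {p e m k} → Prime p → Squarefree (+ e) → m ≢ 0 →
                  p * (m * m) ≡ e * (k * k) → e ≡ p
  p*m²≡e*k²⇒e≡p {p} {e} {m} {k} pr sf m≢0 eq =
    coprime∧p*m²≡e*k²⇒e≡p pr sf (coprime-/gcd m k) (*-cancelʳ-≡ _ _ (g * g) scaled)
    where
    g = gcd m k
    instance
      g≢0 : NonZero g
      g≢0 = ≢-nonZero (gcd[m,n]≢0 m k (inj₁ m≢0))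
      g²≢0 : NonZero (g * g)
      g²≢0 = m*n≢0 g g
    regroup : ∀ a n g → a * (n * n) * (g * g) ≡ a * (n * g * (n * g))
    regroup = ℕ-Solver.solve-∀
    scaled : p * (m / g * (m / g)) * (g * g) ≡ e * (k / g * (k / g)) * (g * g)
    scaled = begin
      p * (m / g * (m / g)) * (g * g)  ≡⟨ regroup p (m / g) g ⟩
      p * (m / g * g * (m / g * g))    ≡⟨ cong (λ n → p * (n * n)) (m/n*n≡m (gcd[m,n]∣m m k)) ⟩
      p * (m * m)                      ≡⟨ eq ⟩
      e * (k * k)                      ≡⟨ cong (λ n → e * (n * n)) (m/n*n≡m (gcd[m,n]∣n m k)) ⟨
      e * (k / g * g * (k / g * g))    ≡⟨ regroup e (k / g) g ⟨
      e * (k / g * (k / g)) * (g * g)  ∎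
      where open ≡-Reasoning

  m*[r²+q²+p²]+pqr<4m³ : ∀ {m p q r} → p < m → q ≤ m → r ≤ m →
                          m * (r * r) + m * (q * q) + m * (p * p) + p * q * r < 4 * (m * m * m)
  m*[r²+q²+p²]+pqr<4m³ {m} {p} {q} {r} p<m q≤m r≤m = begin-strict
    m * (r * r) + m * (q * q) + m * (p * p) + p * q * r
      <⟨ +-mono-<-≤ (+-mono-≤-< (+-mono-≤ (square≤ r≤m) (square≤ q≤m)) p²<) pqr≤ ⟩
    m * (m * m) + m * (m * m) + m * (m * m) + m * m * m
      ≡⟨ ℕ-Solver.solve (m ∷ []) ⟩
    4 * (m * m * m) ∎
    where
    open ≤-Reasoning
    instance _ = >-nonZero (≤-<-trans z≤n p<m)
    square≤ : ∀ {n} → n ≤ m → m * (n * n) ≤ m * (m * m)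
    square≤ n≤m = *-monoʳ-≤ m (*-mono-≤ n≤m n≤m)
    p²< : m * (p * p) < m * (m * m)
    p²< = *-monoʳ-< m (*-mono-< p<m p<m)
    pqr≤ : p * q * r ≤ m * m * m
    pqr≤ = *-mono-≤ (*-mono-≤ (<⇒≤ p<m) q≤m) r≤m

module SignedSelection {A : Set} (_≟_ : DecidableEquality A) (neg : A → A) where

  _≢±_ : A → A → Set
  x ≢± y = x ≢ y × y ≢ neg x

  _∈⟨_,_⟩ : A → A → A → Set
  w ∈⟨ a , b ⟩ = w ≡ a ⊎ w ≡ b

  one-of-three-avoids : ∀ {x y z} a b → x ≢ y → x ≢ z → y ≢ z →
                        ¬ x ∈⟨ a , b ⟩ ⊎ ¬ y ∈⟨ a , b ⟩ ⊎ ¬ z ∈⟨ a , b ⟩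
  one-of-three-avoids {x} {y} {z} a b x≢y x≢z y≢z
    with (x ≟ a) ⊎-dec (x ≟ b) | (y ≟ a) ⊎-dec (y ≟ b) | (z ≟ a) ⊎-dec (z ≟ b)
  ... | no x∉ | _     | _     = inj₁ x∉
  ... | yes _ | no y∉ | _     = inj₂ (inj₁ y∉)
  ... | yes _ | yes _ | no z∉ = inj₂ (inj₂ z∉)
  ... | yes (inj₁ p) | yes (inj₁ q) | yes _        = ⊥-elim (x≢y (trans p (sym q)))
  ... | yes (inj₂ p) | yes (inj₂ q) | yes _        = ⊥-elim (x≢y (trans p (sym q)))
  ... | yes (inj₁ p) | yes (inj₂ _) | yes (inj₁ r) = ⊥-elim (x≢z (trans p (sym r)))
  ... | yes (inj₂ p) | yes (inj₁ _) | yes (inj₂ r) = ⊥-elim (x≢z (trans p (sym r)))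
  ... | yes (inj₁ _) | yes (inj₂ q) | yes (inj₂ r) = ⊥-elim (y≢z (trans q (sym r)))
  ... | yes (inj₂ _) | yes (inj₁ q) | yes (inj₁ r) = ⊥-elim (y≢z (trans q (sym r)))

  module _ (f : Fin 5 → A) (f-inj : Injective _≡_ _≡_ f) where

    PairwiseApart : Fin 5 → Fin 5 → Fin 5 → Set
    PairwiseApart i j k = f i ≢± f j × f i ≢± f k × f j ≢± f k

    private
      f≢ : ∀ s t → s ≢ t → f s ≢ f t
      f≢ s t s≢t = s≢t ∘ f-inj

      apart : ∀ {i j k} → i ≢ j → i ≢ k → j ≢ k → f j ≢ neg (f i) →
              ¬ f k ∈⟨ neg (f i) , neg (f j) ⟩ → PairwiseApart i j k
      apart {i} {j} {k} i≢j i≢k j≢k fj≢-fi fk∉ =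
        (f≢ i j i≢j , fj≢-fi) , (f≢ i k i≢k , fk∉ ∘ inj₁) , (f≢ j k j≢k , fk∉ ∘ inj₂)

      f₂≢-f₀ : f (# 1) ≡ neg (f (# 0)) → f (# 2) ≢ neg (f (# 0))
      f₂≢-f₀ f₁≡-f₀ f₂≡-f₀ = f≢ (# 2) (# 1) (λ ()) (trans f₂≡-f₀ (sym f₁≡-f₀))

    three-pairwise-apart : ∃ λ i → ∃ λ j → ∃ λ k → PairwiseApart i j k
    three-pairwise-apart with f (# 1) ≟ neg (f (# 0))
    ... | no f₁≢-f₀
        with one-of-three-avoids (neg (f (# 0))) (neg (f (# 1)))
               (f≢ (# 2) (# 3) (λ ())) (f≢ (# 2) (# 4) (λ ())) (f≢ (# 3) (# 4) (λ ()))
    ...   | inj₁ f₂∉        = # 0 , # 1 , # 2 , apart (λ ()) (λ ()) (λ ()) f₁≢-f₀ f₂∉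
    ...   | inj₂ (inj₁ f₃∉) = # 0 , # 1 , # 3 , apart (λ ()) (λ ()) (λ ()) f₁≢-f₀ f₃∉
    ...   | inj₂ (inj₂ f₄∉) = # 0 , # 1 , # 4 , apart (λ ()) (λ ()) (λ ()) f₁≢-f₀ f₄∉
    three-pairwise-apart | yes f₁≡-f₀
        with one-of-three-avoids (neg (f (# 0))) (neg (f (# 2)))
               (f≢ (# 1) (# 3) (λ ())) (f≢ (# 1) (# 4) (λ ())) (f≢ (# 3) (# 4) (λ ()))
    ...   | inj₁ f₁∉        = ⊥-elim (f₁∉ (inj₁ f₁≡-f₀))
    ...   | inj₂ (inj₁ f₃∉) = # 0 , # 2 , # 3 , apart (λ ()) (λ ()) (λ ()) (f₂≢-f₀ f₁≡-f₀) f₃∉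
    ...   | inj₂ (inj₂ f₄∉) = # 0 , # 2 , # 4 , apart (λ ()) (λ ()) (λ ()) (f₂≢-f₀ f₁≡-f₀) f₄∉

open import Data.Integer
  using (-[1+_]; 0ℤ; _+_; _-_; _*_; ∣_∣; _≤_; +≤+)
import Data.Integer.Properties as ℤ
open import Data.Integer.Tactic.RingSolver using (solve-∀)
import Data.Nat as ℕ
import Data.Nat.Properties as ℕ

Q : ℤ → Elt → ℤ
Q e (u , v) = u * u + e * (v * v)

polar : ℤ → Elt → Elt → ℤ
polar e (u , v) (u′ , v′) = + 2 * (u * u′ + e * (v * v′))

det : Elt → Elt → ℤ
det (u , v) (u′ , v′) = u * v′ - v * u′

Q-add : ∀ e x y → Q e (addE x y) ≡ Q e x + (Q e y + polar e x y)
Q-add e (a , b) (c , d) = identity e a b c d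
  where
  identity : ∀ e a b c d →
    let q u v = u * u + e * (v * v)
    in q (a + c) (b + d) ≡ q a b + (q c d + + 2 * (a * c + e * (b * d)))
  identity = solve-∀

Q-sub : ∀ e x y → Q e (addE x (negE y)) ≡ Q e x + (Q e y - polar e x y)
Q-sub e (a , b) (c , d) = identity e a b c d
  where
  identity : ∀ e a b c d →
    let q u v = u * u + e * (v * v)
    in q (a - c) (b - d) ≡ q a b + (q c d - + 2 * (a * c + e * (b * d)))
  identity = solve-∀

Q-lagrange : ∀ e x y →
  + 4 * (Q e x * Q e y) ≡ polar e x y * polar e x y + e * (+ 2 * det x y * (+ 2 * det x y))
Q-lagrange e (a , b) (c , d) = identity e a b c d
  where
  identity : ∀ e a b c d →
    let q u v = u * u + e * (v * v)
        p u v s t = + 2 * (u * s + e * (v * t))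
        k = + 2 * (a * d - b * c)
    in + 4 * (q a b * q c d) ≡ p a b c d * p a b c d + e * (k * k)
  identity = solve-∀

-- The Gram determinant of three vectors of ℤ², taken with respect to Q, vanishes.
Q-gram : ∀ e x y z →
  + 4 * (Q e x * Q e y * Q e z) + polar e x y * polar e x z * polar e y z
    ≡ Q e x * (polar e y z * polar e y z) + Q e y * (polar e x z * polar e x z)
      + Q e z * (polar e x y * polar e x y)
Q-gram e (a , b) (c , d) (f , g) = identity e a b c d f g
  where
  identity : ∀ e a b c d f g →
    let q u v = u * u + e * (v * v)
        p u v s t = + 2 * (u * s + e * (v * t))
    in + 4 * (q a b * q c d * q f g) + p a b c d * p a b f g * p c d f g
         ≡ q a b * (p c d f g * p c d f g) + q c d * (p a b f g * p a b f g)
           + q f g * (p a b c d * p a b c d)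
  identity = solve-∀

Q-gram-isonorm : ∀ e {m} x y z → Q e x ≡ m → Q e y ≡ m → Q e z ≡ m →
  + 4 * (m * m * m) + polar e x y * polar e x z * polar e y z
    ≡ m * (polar e y z * polar e y z) + m * (polar e x z * polar e x z)
      + m * (polar e x y * polar e x y)
Q-gram-isonorm e x y z refl qy qz =
  trans (cong₂ (λ b c → + 4 * (Q e x * b * c) + pxy * pxz * pyz) (sym qy) (sym qz))
        (trans (Q-gram e x y z)
               (cong₂ (λ b c → Q e x * (pyz * pyz) + b * (pxz * pxz) + c * (pxy * pxy)) qy qz))
  where
  pxy = polar e x y
  pxz = polar e x z
  pyz = polar e y z

Qℕ : ℕ.ℕ → Elt → ℕ.ℕ
Qℕ e (u , v) = ∣ u ∣ ℕ.* ∣ u ∣ ℕ.+ e ℕ.* (∣ v ∣ ℕ.* ∣ v ∣)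

i*i≡+∣i∣*∣i∣ : ∀ i → i * i ≡ + (∣ i ∣ ℕ.* ∣ i ∣)
i*i≡+∣i∣*∣i∣ (+ n)    = sym (ℤ.pos-* n n)
i*i≡+∣i∣*∣i∣ -[1+ n ] = refl

Q≡+Qℕ : ∀ e x → Q (+ e) x ≡ + Qℕ e x
Q≡+Qℕ e (u , v) = begin
  u * u + + e * (v * v)
    ≡⟨ cong₂ (λ a b → a + + e * b) (i*i≡+∣i∣*∣i∣ u) (i*i≡+∣i∣*∣i∣ v) ⟩
  + (∣ u ∣ ℕ.* ∣ u ∣) + + e * + (∣ v ∣ ℕ.* ∣ v ∣)
    ≡⟨ cong (_+_ (+ (∣ u ∣ ℕ.* ∣ u ∣))) (ℤ.pos-* e _) ⟨
  + (∣ u ∣ ℕ.* ∣ u ∣) + + (e ℕ.* (∣ v ∣ ℕ.* ∣ v ∣))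
    ≡⟨ ℤ.pos-+ (∣ u ∣ ℕ.* ∣ u ∣) _ ⟨
  + Qℕ e (u , v) ∎
  where open ≡-Reasoning

Qℕ≢0 : ∀ {e} x → e ≢ 0 → x ≢ zeroE → Qℕ e x ≢ 0
Qℕ≢0 {e} (u , v) e≢0 x≢0 Qx≡0 = x≢0 (cong₂ _,_ (ℤ.∣i∣≡0⇒i≡0 ∣u∣≡0) (ℤ.∣i∣≡0⇒i≡0 ∣v∣≡0))
  where
  square≡0 : ∀ {n} → n ℕ.* n ≡ 0 → n ≡ 0
  square≡0 {n} n²≡0 with ℕ.m*n≡0⇒m≡0∨n≡0 n n²≡0
  ... | inj₁ n≡0 = n≡0
  ... | inj₂ n≡0 = n≡0
  ∣u∣≡0 : ∣ u ∣ ≡ 0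
  ∣u∣≡0 = square≡0 (ℕ.m+n≡0⇒m≡0 _ Qx≡0)
  ∣v∣≡0 : ∣ v ∣ ≡ 0
  ∣v∣≡0 with ℕ.m*n≡0⇒m≡0∨n≡0 e (ℕ.m+n≡0⇒n≡0 (∣ u ∣ ℕ.* ∣ u ∣) Qx≡0)
  ... | inj₁ e≡0  = ⊥-elim (e≢0 e≡0)
  ... | inj₂ v²≡0 = square≡0 v²≡0

addE-negE≢zeroE : ∀ {x y} → x ≢ y → addE x (negE y) ≢ zeroE
addE-negE≢zeroE {a , b} {c , d} x≢y x-y≡0 =
  x≢y (cong₂ _,_ (ℤ.i-j≡0⇒i≡j a c (cong proj₁ x-y≡0)) (ℤ.i-j≡0⇒i≡j b d (cong proj₂ x-y≡0)))

addE≢zeroE : ∀ {x y} → y ≢ negE x → addE x y ≢ zeroE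
addE≢zeroE {a , b} {c , d} y≢-x x+y≡0 =
  y≢-x (cong₂ _,_ (ℤ.i-j≡0⇒i≡j c (- a) (trans (swap c a) (cong proj₁ x+y≡0)))
                  (ℤ.i-j≡0⇒i≡j d (- b) (trans (swap d b) (cong proj₂ x+y≡0))))
  where
  swap : ∀ c a → c - - a ≡ a + c
  swap = solve-∀

i≤i+j⇒0≤j : ∀ {i j} → i ≤ i + j → 0ℤ ≤ j
i≤i+j⇒0≤j {i} {j} i≤i+j = subst (0ℤ ≤_) (cancel i j) (ℤ.i≤j⇒0≤j-i i≤i+j)
  where
  cancel : ∀ i j → i + j - i ≡ j
  cancel = solve-∀

0≤m∓p⇒∣p∣≤m : ∀ m p → 0ℤ ≤ + m - p → 0ℤ ≤ + m + p → ∣ p ∣ ℕ.≤ m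
0≤m∓p⇒∣p∣≤m m (+ n)    0≤m-p _     = ℤ.drop‿+≤+ (ℤ.0≤i-j⇒j≤i 0≤m-p)
0≤m∓p⇒∣p∣≤m m -[1+ n ] _     0≤m+p = ℤ.drop‿+≤+ (ℤ.0≤i-j⇒j≤i 0≤m+p)

4m²≡p²+e*k²⇒3m²≡e*∣k∣² : ∀ {m e} p k → ∣ p ∣ ≡ m → + 4 * (+ m * + m) ≡ p * p + + e * (k * k) →
                          3 ℕ.* (m ℕ.* m) ≡ e ℕ.* (∣ k ∣ ℕ.* ∣ k ∣)
4m²≡p²+e*k²⇒3m²≡e*∣k∣² {m} {e} p k refl eq = ℕ.+-cancelˡ-≡ (m ℕ.* m) _ _ (ℤ.+-injective (begin
  + (4 ℕ.* (m ℕ.* m))                             ≡⟨ ℤ.pos-* 4 (m ℕ.* m) ⟩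
  + 4 * + (m ℕ.* m)                               ≡⟨ cong (+ 4 *_) (ℤ.pos-* m m) ⟩
  + 4 * (+ m * + m)                               ≡⟨ eq ⟩
  p * p + + e * (k * k)
    ≡⟨ cong₂ (λ a b → a + + e * b) (i*i≡+∣i∣*∣i∣ p) (i*i≡+∣i∣*∣i∣ k) ⟩
  + (m ℕ.* m) + + e * + (∣ k ∣ ℕ.* ∣ k ∣)         ≡⟨ cong (_+_ (+ (m ℕ.* m))) (ℤ.pos-* e _) ⟨
  + (m ℕ.* m) + + (e ℕ.* (∣ k ∣ ℕ.* ∣ k ∣))       ≡⟨ ℤ.pos-+ (m ℕ.* m) _ ⟨
  + (m ℕ.* m ℕ.+ e ℕ.* (∣ k ∣ ℕ.* ∣ k ∣))         ∎))
  where open ≡-Reasoning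

4m³≤m*[∣r∣²+∣q∣²+∣p∣²]+∣pqr∣ : ∀ m p q r →
  + 4 * (+ m * + m * + m) + p * q * r ≡ + m * (r * r) + + m * (q * q) + + m * (p * p) →
  4 ℕ.* (m ℕ.* m ℕ.* m) ℕ.≤
    m ℕ.* (∣ r ∣ ℕ.* ∣ r ∣) ℕ.+ m ℕ.* (∣ q ∣ ℕ.* ∣ q ∣) ℕ.+ m ℕ.* (∣ p ∣ ℕ.* ∣ p ∣)
      ℕ.+ ∣ p ∣ ℕ.* ∣ q ∣ ℕ.* ∣ r ∣
4m³≤m*[∣r∣²+∣q∣²+∣p∣²]+∣pqr∣ m p q r eq = begin
  4 ℕ.* (m ℕ.* m ℕ.* m)            ≡⟨ ∣4m³∣ ⟨
  ∣ + 4 * (+ m * + m * + m) ∣      ≡⟨ cong ∣_∣ 4m³≡sum-pqr ⟩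
  ∣ sum - p * q * r ∣              ≤⟨ ℤ.∣i-j∣≤∣i∣+∣j∣ sum (p * q * r) ⟩
  ∣ sum ∣ ℕ.+ ∣ p * q * r ∣        ≤⟨ ℕ.+-monoˡ-≤ _ (ℕ.≤-trans (ℤ.∣i+j∣≤∣i∣+∣j∣ (mr² + mq²) mp²)
                                        (ℕ.+-monoˡ-≤ _ (ℤ.∣i+j∣≤∣i∣+∣j∣ mr² mq²))) ⟩
  ∣ mr² ∣ ℕ.+ ∣ mq² ∣ ℕ.+ ∣ mp² ∣ ℕ.+ ∣ p * q * r ∣
    ≡⟨ cong₂ ℕ._+_ (cong₂ ℕ._+_ (cong₂ ℕ._+_ (∣m*i*i∣ r) (∣m*i*i∣ q)) (∣m*i*i∣ p)) ∣pqr∣ ⟩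
  m ℕ.* (∣ r ∣ ℕ.* ∣ r ∣) ℕ.+ m ℕ.* (∣ q ∣ ℕ.* ∣ q ∣) ℕ.+ m ℕ.* (∣ p ∣ ℕ.* ∣ p ∣)
    ℕ.+ ∣ p ∣ ℕ.* ∣ q ∣ ℕ.* ∣ r ∣ ∎
  where
  open ℕ.≤-Reasoning
  mr² = + m * (r * r)
  mq² = + m * (q * q)
  mp² = + m * (p * p)
  sum = mr² + mq² + mp²
  cancel : ∀ x w → x + w - w ≡ x
  cancel = solve-∀
  4m³≡sum-pqr : + 4 * (+ m * + m * + m) ≡ sum - p * q * r
  4m³≡sum-pqr = trans (sym (cancel (+ 4 * (+ m * + m * + m)) (p * q * r)))
                      (cong (_- p * q * r) eq)
  ∣4m³∣ : ∣ + 4 * (+ m * + m * + m) ∣ ≡ 4 ℕ.* (m ℕ.* m ℕ.* m)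
  ∣4m³∣ = trans (ℤ.abs-* (+ 4) (+ m * + m * + m))
                (cong (4 ℕ.*_) (trans (ℤ.abs-* (+ m * + m) (+ m))
                                      (cong (ℕ._* m) (ℤ.abs-* (+ m) (+ m)))))
  ∣m*i*i∣ : ∀ i → ∣ + m * (i * i) ∣ ≡ m ℕ.* (∣ i ∣ ℕ.* ∣ i ∣)
  ∣m*i*i∣ i = trans (ℤ.abs-* (+ m) (i * i)) (cong (m ℕ.*_) (ℤ.abs-* i i))
  ∣pqr∣ : ∣ p * q * r ∣ ≡ ∣ p ∣ ℕ.* ∣ q ∣ ℕ.* ∣ r ∣
  ∣pqr∣ = trans (ℤ.abs-* (p * q) r) (cong (ℕ._* ∣ r ∣) (ℤ.abs-* p q))

IsShortest : ℕ.ℕ → (Elt → Set) → Elt → Set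
IsShortest e L x = L x × x ≢ zeroE × (∀ y → L y → y ≢ zeroE → Qℕ e x ℕ.≤ Qℕ e y)

normSq4≡c*Qℕ : ∀ D → ∃ λ c → ∀ x → normSq4 D x ≡ + (ℕ.suc c ℕ.* Qℕ ∣ D ∣ x)
normSq4≡c*Qℕ (+ n) = 1 , λ x@(_ , _) →
  trans (cong (+ 2 *_) (Q≡+Qℕ n x)) (sym (ℤ.pos-* 2 (Qℕ n x)))
normSq4≡c*Qℕ -[1+ n ] = 0 , λ x@(u , v) →
  trans (neg-coefficient u v -[1+ n ])
        (trans (Q≡+Qℕ (ℕ.suc n) x) (cong +_ (sym (ℕ.*-identityˡ _))))
  where
  neg-coefficient : ∀ u v d → u * u - d * (v * v) ≡ u * u + (- d) * (v * v)
  neg-coefficient = solve-∀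

minimal⇒shortest : ∀ {D I x} → IsMinimal D I x → IsShortest ∣ D ∣ I x
minimal⇒shortest {D} {x = x} (Ix , x≢0 , x-min) = Ix , x≢0 , λ y Iy y≢0 →
  ℕ.*-cancelˡ-≤ (ℕ.suc c) (ℤ.drop‿+≤+ (subst₂ _≤_ (scale x) (scale y) (x-min y Iy y≢0)))
  where
  c = proj₁ (normSq4≡c*Qℕ D)
  scale = proj₂ (normSq4≡c*Qℕ D)

open SignedSelection (≡-dec ℤ._≟_ ℤ._≟_) negE

module _ (e : ℕ.ℕ) (L : Elt → Set)
         (closed+ : ∀ x y → L x → L y → L (addE x y))
         (closed- : ∀ x → L x → L (negE x)) where

  shortest⇒Qℕ≡ : ∀ {x y} → IsShortest e L x → IsShortest e L y → Qℕ e y ≡ Qℕ e x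
  shortest⇒Qℕ≡ (Lx , x≢0 , x-min) (Ly , y≢0 , y-min) =
    ℕ.≤-antisym (y-min _ Lx x≢0) (x-min _ Ly y≢0)

  shortest⇒Q≡ : ∀ {x y} → IsShortest e L x → IsShortest e L y → Q (+ e) y ≡ + Qℕ e x
  shortest⇒Q≡ {y = y} x-short y-short = trans (Q≡+Qℕ e y) (cong +_ (shortest⇒Qℕ≡ x-short y-short))

  ∣polar∣≤Qℕ : ∀ {x y} → IsShortest e L x → IsShortest e L y → x ≢± y →
               ∣ polar (+ e) x y ∣ ℕ.≤ Qℕ e x
  ∣polar∣≤Qℕ {x} {y} x-short@(Lx , _ , x-min) y-short@(Ly , _ , _) (x≢y , y≢-x) =
    0≤m∓p⇒∣p∣≤m (Qℕ e x) (polar (+ e) x y)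
      (exceeds-Qx (closed+ _ _ Lx (closed- _ Ly)) (addE-negE≢zeroE x≢y)
                  (trans (Q-sub (+ e) x y) (cong (λ q → Q (+ e) x + (q - polar (+ e) x y)) Qy≡)))
      (exceeds-Qx (closed+ _ _ Lx Ly) (addE≢zeroE y≢-x)
                  (trans (Q-add (+ e) x y) (cong (λ q → Q (+ e) x + (q + polar (+ e) x y)) Qy≡)))
    where
    Qy≡ = shortest⇒Q≡ x-short y-short
    exceeds-Qx : ∀ {z c} → L z → z ≢ zeroE → Q (+ e) z ≡ Q (+ e) x + c → 0ℤ ≤ c
    exceeds-Qx {z} Lz z≢0 Qz≡ = i≤i+j⇒0≤j
      (subst₂ _≤_ (sym (Q≡+Qℕ e x)) (trans (sym (Q≡+Qℕ e z)) Qz≡) (+≤+ (x-min z Lz z≢0)))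

  ∣polar∣<Qℕ : Squarefree (+ e) → e ≢ 3 → ∀ {x y} →
               IsShortest e L x → IsShortest e L y → x ≢± y → ∣ polar (+ e) x y ∣ ℕ.< Qℕ e x
  ∣polar∣<Qℕ sf e≢3 {x} {y} x-short@(_ , x≢0 , _) y-short x≢±y
    with ℕ.m≤n⇒m<n∨m≡n (∣polar∣≤Qℕ x-short y-short x≢±y)
  ... | inj₁ ∣P∣<M = ∣P∣<M
  ... | inj₂ ∣P∣≡M = ⊥-elim (e≢3 (p*m²≡e*k²⇒e≡p {e = e} {k = ∣ K ∣} prime[3] sf M≢0 3M²≡eκ²))
    where
    P = polar (+ e) x y
    K = + 2 * det x y
    M≢0 = Qℕ≢0 x (squarefree⇒≢0 sf) x≢0
    lagrange : + 4 * (+ Qℕ e x * + Qℕ e x) ≡ P * P + + e * (K * K)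
    lagrange = trans (cong₂ (λ a b → + 4 * (a * b)) (sym (Q≡+Qℕ e x))
                                                     (sym (shortest⇒Q≡ x-short y-short)))
                     (Q-lagrange (+ e) x y)
    3M²≡eκ² : 3 ℕ.* (Qℕ e x ℕ.* Qℕ e x) ≡ e ℕ.* (∣ K ∣ ℕ.* ∣ K ∣)
    3M²≡eκ² = 4m²≡p²+e*k²⇒3m²≡e*∣k∣² {e = e} P K ∣P∣≡M lagrange

  no-three-pairwise-apart-shortest : Squarefree (+ e) → e ≢ 3 → ∀ {x y z} →
    IsShortest e L x → IsShortest e L y → IsShortest e L z → x ≢± y → x ≢± z → y ≢± z → ⊥
  no-three-pairwise-apart-shortest sf e≢3 {x} {y} {z} x-short y-short z-short x≢±y x≢±z y≢±z =
    ℕ.<⇒≱ (m*[r²+q²+p²]+pqr<4m³ ∣Pxy∣<M ∣Pxz∣≤M ∣Pyz∣≤M)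
          (4m³≤m*[∣r∣²+∣q∣²+∣p∣²]+∣pqr∣ M (polar (+ e) x y) (polar (+ e) x z) (polar (+ e) y z)
            (Q-gram-isonorm (+ e) x y z (Q≡+Qℕ e x) (shortest⇒Q≡ x-short y-short)
                                                    (shortest⇒Q≡ x-short z-short)))
    where
    M = Qℕ e x
    ∣Pxy∣<M = ∣polar∣<Qℕ sf e≢3 x-short y-short x≢±y
    ∣Pxz∣≤M = ∣polar∣≤Qℕ x-short z-short x≢±z
    ∣Pyz∣≤M = subst (∣ polar (+ e) y z ∣ ℕ.≤_) (shortest⇒Qℕ≡ x-short y-short)
                    (∣polar∣≤Qℕ y-short z-short y≢±z)

  no-five-shortest : Squarefree (+ e) → e ≢ 3 → (f : Fin 5 → Elt) → Injective _≡_ _≡_ f →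
                     (∀ i → IsShortest e L (f i)) → ⊥
  no-five-shortest sf e≢3 f f-inj f-short with three-pairwise-apart f f-inj
  ... | i , j , k , fi≢±fj , fi≢±fk , fj≢±fk =
    no-three-pairwise-apart-shortest sf e≢3 (f-short i) (f-short j) (f-short k) fi≢±fj fi≢±fk fj≢±fk

∣i∣≢n : ∀ {i n} → i ≢ + n → i ≢ - + n → ∣ i ∣ ≢ n
∣i∣≢n {+ _}      i≢n _    refl = i≢n refl
∣i∣≢n { -[1+ _ ]} _   i≢-n refl = i≢-n refl

lemma2p10 : (D : ℤ) → Squarefree D → D ≢ + 1 → D ≢ + 3 → D ≢ - (+ 3) →
    (I : Elt → Set) → IsNonzeroIdeal D I → AtMostFourMinimal D I
lemma2p10 D sf _ D≢3 D≢-3 I ideal f f-inj f-minimal =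
  no-five-shortest ∣ D ∣ I closed+ closed- sf (∣i∣≢n D≢3 D≢-3)
                   f f-inj (minimal⇒shortest {D} ∘ f-minimal)
  where open IsNonzeroIdeal ideal
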